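{- Let $\mathcal{R}=(\mathcal{X},(\mathcal{M},\mathcal{I}))$ be a reflexive graph category with isomorphisms that has terminal objects stable under face maps and degeneracies. Then for every natural number $n$ the category $\mathcal{M}^n\to\mathcal{M}$ has a terminal object.
   Context: Fix a locally small category $\mathcal{C}$ with finite products. An internal category $C$ in $\mathcal{C}$ has $C_0,C_1$, $\mathsf{s}_C,\mathsf{t}_C:C_1\to C_0$, $\mathsf{id}_C:C_0\to C_1$, composition; for generalized elements write $\mathsf{id}_C[a]=\mathsf{id}_C\circ a$, $g\circ_C f$ for composition. Internal functors $F$ have parts $F_0,F_1$. $C$ has a terminal object if it has an arrow $1_C:1\to C_0$ such that for every $a:J\to C_0$ there is a unique $!_C(a):J\to C_1$ with $\mathsf{s}_C\circ !_C(a)=a$ and $\mathsf{t}_C\circ !_C(a)=1_C\circ !J$. A reflexive graph category $\mathcal{X}$: internal categories $\mathcal{X}(0),\mathcal{X}(1)$, distinct internal functors $\mathcal{X}(\mathbf{f}_\top),\mathcal{X}(\mathbf{f}_\bot):\mathcal{X}(1)\to\mathcal{X}(0)$, internal functor $\mathcal{X}(\mathbf{d}):\mathcal{X}(0)\to\mathcal{X}(1)$ with $\mathcal{X}(\mathbf{f}_\star)\circ\mathcal{X}(\mathbf{d})=\mathsf{id}$ for $\star\in\{\top,\bot\}$; $\mathcal{X}^n$ is the levelwise product. A reflexive graph functor $\mathcal{F}:\mathcal{X}\to\mathcal{Y}$ is a pair of internal functors $\mathcal{F}(l):\mathcal{X}(l)\to\mathcal{Y}(l)$; face map-preserving: $\mathcal{Y}(\mathbf{f}_\star)\circ\mathcal{F}(1)=\mathcal{F}(0)\circ\mathcal{X}(\mathbf{f}_\star)$;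 degeneracy-preserving: equipped with an internal natural isomorphism $\varepsilon_\mathcal{F}:\mathcal{Y}(\mathbf{d})\circ\mathcal{F}(0)\Rightarrow\mathcal{F}(1)\circ\mathcal{X}(\mathbf{d})$ with $\mathcal{Y}(\mathbf{f}_\star)_1\circ\varepsilon_\mathcal{F}=\mathsf{id}_{\mathcal{Y}(0)}[\mathcal{F}(0)_0]$. A reflexive graph natural transformation $\eta:\mathcal{F}\to\mathcal{G}$ is a pair of internal natural transformations $\eta(l):\mathcal{F}(l)\Rightarrow\mathcal{G}(l)$; face map-preserving: $\mathcal{Y}(\mathbf{f}_\star)_1\circ\eta(1)=\eta(0)\circ\mathcal{X}(\mathbf{f}_\star)_0$; degeneracy-preserving: $(\eta(1)\circ\mathcal{X}(\mathbf{d})_0)\circ_{\mathcal{Y}(1)}\varepsilon_\mathcal{F}=\varepsilon_\mathcal{G}\circ_{\mathcal{Y}(1)}(\mathcal{Y}(\mathbf{d})_1\circ\eta(0))$. Composites with $\mathcal{I}$ below are levelwise, with $\varepsilon_{\mathcal{I}\circ\mathcal{F}}=\mathcal{I}(1)_1\circ\varepsilon_\mathcal{F}$. A reflexive graph category with isomorphisms $(\mathcal{X},(\mathcal{M},\mathcal{I}))$: $\mathcal{M}$ a reflexive graph category and $\mathcal{I}:\mathcal{M}\to\mathcal{X}$ a reflexive graph functor with each $\mathcal{I}(l)_0$ an isomorphism and $\mathcal{I}(l)_1$ monic, commuting strictly with face maps and degeneracies, and such that every morphism of $\mathcal{M}(l)$ is an isomorphism; a morphism of $\mathcal{X}(l)$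 is "in $\mathcal{M}(l)$" if it lies in the image of $\mathcal{I}(l)_1$. The category $\mathcal{M}^n\to\mathcal{M}$ has objects the face map- and degeneracy-preserving reflexive graph functors $\mathcal{M}^n\to\mathcal{M}$ and morphisms $\mathcal{F}\to\mathcal{G}$ the face map- and degeneracy-preserving reflexive graph natural transformations $\mathcal{I}\circ\mathcal{F}\to\mathcal{I}\circ\mathcal{G}$. $(\mathcal{X},(\mathcal{M},\mathcal{I}))$ has terminal objects if each $\mathcal{X}(l)$ has a terminal object; they are stable under face maps if $\mathcal{X}(\mathbf{f}_\star)_0\circ 1_{\mathcal{X}(1)}=1_{\mathcal{X}(0)}$ with the canonical comparison morphism an identity, for both $\star$; they are stable under degeneracies if the canonical morphism $\eta^1_\mathcal{X}:\mathcal{X}(\mathbf{d})_0\circ 1_{\mathcal{X}(0)}\to 1_{\mathcal{X}(1)}$ in $\mathcal{X}(1)$ is an isomorphism lying in the image of $\mathcal{I}(1)_1$. -}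

module Defs where

open import Level using (Level; _⊔_) renaming (suc to lsuc)
open import Data.Nat using (ℕ; zero; suc)
open import Data.Product using (Σ; Σ-syntax; _×_; _,_)
open import Relation.Binary.PropositionalEquality using (_≡_; refl; sym; trans; cong)
open import Relation.Nullary using (¬_)

record Category (o ℓ : Level) : Set (lsuc (o ⊔ ℓ)) where
  infixr 9 _∘_
  field
    Obj   : Set o
    Hom   : Obj → Obj → Set ℓ
    _∘_   : ∀ {A B C} → Hom B C → Hom A B → Hom A C
    id    : ∀ {A} → Hom A A
    assoc : ∀ {A B C D} (h : Hom C D) (g : Hom B C) (f : Hom A B) →
            (h ∘ g) ∘ f ≡ h ∘ (g ∘ f)
    identityˡ : ∀ {A B} (f : Hom A B) → id ∘ f ≡ f
    identityʳ : ∀ {A B} (f : Hom A B) → f ∘ id ≡ f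

record FinProducts {o ℓ : Level} (𝒞 : Category o ℓ) : Set (o ⊔ ℓ) where
  open Category 𝒞
  infixr 5 _⊗_
  field
    𝟙        : Obj
    !        : (A : Obj) → Hom A 𝟙
    !-unique : ∀ {A} (f : Hom A 𝟙) → f ≡ ! A
    _⊗_      : Obj → Obj → Obj
    π₁       : ∀ {A B} → Hom (A ⊗ B) A
    π₂       : ∀ {A B} → Hom (A ⊗ B) B
    ⟨_,_⟩    : ∀ {C A B} → Hom C A → Hom C B → Hom C (A ⊗ B)
    β₁       : ∀ {C A B} (f : Hom C A) (g : Hom C B) → π₁ ∘ ⟨ f , g ⟩ ≡ f
    β₂       : ∀ {C A B} (f : Hom C A) (g : Hom C B) → π₂ ∘ ⟨ f , g ⟩ ≡ g
    ⟨⟩-unique : ∀ {C A B} (f : Hom C A) (g : Hom C B) (h : Hom C (A ⊗ B)) →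
                π₁ ∘ h ≡ f → π₂ ∘ h ≡ g → h ≡ ⟨ f , g ⟩

module Internal {o ℓ : Level} (𝒞 : Category o ℓ) (P : FinProducts 𝒞) where
  open Category 𝒞
  open FinProducts P

  -- Since 𝒞 only has finite products, composition
  -- is given on generalized elements: for composable f g : J → C1
  -- (t ∘ f ≡ s ∘ g) we get  comp f g p = g ∘_C f : J → C1,
  -- natural in J.

  record ICatData : Set (o ⊔ ℓ) where
    field
      C0 C1 : Obj
      s t   : Hom C1 C0
      idm   : Hom C0 C1
      comp  : ∀ {J} (f g : Hom J C1) → t ∘ f ≡ s ∘ g → Hom J C1

  record IsICat (C : ICatData) : Set (o ⊔ ℓ) where
    open ICatData C
    field
      comp-nat : ∀ {J K} (f g : Hom J C1) (p : t ∘ f ≡ s ∘ g) (h : Hom K J)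
                 (q : t ∘ (f ∘ h) ≡ s ∘ (g ∘ h)) →
                 comp (f ∘ h) (g ∘ h) q ≡ comp f g p ∘ h
      s-idm : s ∘ idm ≡ id
      t-idm : t ∘ idm ≡ id
      s-comp : ∀ {J} (f g : Hom J C1) (p : t ∘ f ≡ s ∘ g) → s ∘ comp f g p ≡ s ∘ f
      t-comp : ∀ {J} (f g : Hom J C1) (p : t ∘ f ≡ s ∘ g) → t ∘ comp f g p ≡ t ∘ g
      unitˡ : ∀ {J} (f : Hom J C1) (p : t ∘ f ≡ s ∘ (idm ∘ (t ∘ f))) →
              comp f (idm ∘ (t ∘ f)) p ≡ f
      unitʳ : ∀ {J} (f : Hom J C1) (p : t ∘ (idm ∘ (s ∘ f)) ≡ s ∘ f) →
              comp (idm ∘ (s ∘ f)) f p ≡ f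
      assocI : ∀ {J} (f g h : Hom J C1)
               (p : t ∘ f ≡ s ∘ g) (q : t ∘ comp f g p ≡ s ∘ h)
               (p' : t ∘ g ≡ s ∘ h) (q' : t ∘ f ≡ s ∘ comp g h p') →
               comp (comp f g p) h q ≡ comp f (comp g h p') q'

  record IFun (C D : ICatData) : Set ℓ where
    field
      F0 : Hom (ICatData.C0 C) (ICatData.C0 D)
      F1 : Hom (ICatData.C1 C) (ICatData.C1 D)

  record IsIFun {C D : ICatData} (F : IFun C D) : Set (o ⊔ ℓ) where
    private
      module C = ICatData C
      module D = ICatData D
    open IFun F
    field
      F-s : D.s ∘ F1 ≡ F0 ∘ C.s
      F-t : D.t ∘ F1 ≡ F0 ∘ C.t
      F-idm : F1 ∘ C.idm ≡ D.idm ∘ F0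
      F-comp : ∀ {J} (f g : Hom J C.C1) (p : C.t ∘ f ≡ C.s ∘ g)
               (q : D.t ∘ (F1 ∘ f) ≡ D.s ∘ (F1 ∘ g)) →
               F1 ∘ C.comp f g p ≡ D.comp (F1 ∘ f) (F1 ∘ g) q

  idF : ∀ {C} → IFun C C
  idF = record { F0 = id ; F1 = id }

  infixr 9 _∘F_
  _∘F_ : ∀ {C D E} → IFun D E → IFun C D → IFun C E
  G ∘F F = record { F0 = IFun.F0 G ∘ IFun.F0 F ; F1 = IFun.F1 G ∘ IFun.F1 F }

  _≈F_ : ∀ {C D} → IFun C D → IFun C D → Set ℓ
  F ≈F G = (IFun.F0 F ≡ IFun.F0 G) × (IFun.F1 F ≡ IFun.F1 G)

  record INat {C D : ICatData} (F G : IFun C D) : Set (o ⊔ ℓ) where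
    private
      module C = ICatData C
      module D = ICatData D
      module F = IFun F
      module G = IFun G
    field
      α   : Hom C.C0 D.C1
      α-s : D.s ∘ α ≡ F.F0
      α-t : D.t ∘ α ≡ G.F0
      α-nat : ∀ {J} (f : Hom J C.C1)
              (p : D.t ∘ (α ∘ (C.s ∘ f)) ≡ D.s ∘ (G.F1 ∘ f))
              (q : D.t ∘ (F.F1 ∘ f) ≡ D.s ∘ (α ∘ (C.t ∘ f))) →
              D.comp (α ∘ (C.s ∘ f)) (G.F1 ∘ f) p ≡ D.comp (F.F1 ∘ f) (α ∘ (C.t ∘ f)) q

  record INatIso {C D : ICatData} (F G : IFun C D) : Set (o ⊔ ℓ) where
    private
      module D = ICatData D
    field
      to   : INat F G
      from : INat G F
    open INat
    field
      from∘to : ∀ (p : D.t ∘ α to ≡ D.s ∘ α from) →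
                D.comp (α to) (α from) p ≡ D.idm ∘ IFun.F0 F
      to∘from : ∀ (p : D.t ∘ α from ≡ D.s ∘ α to) →
                D.comp (α from) (α to) p ≡ D.idm ∘ IFun.F0 G

  record ITerminal (C : ICatData) : Set (o ⊔ ℓ) where
    open ICatData C
    field
      1C     : Hom 𝟙 C0
      bang   : ∀ {J} (a : Hom J C0) → Hom J C1
      bang-s : ∀ {J} (a : Hom J C0) → s ∘ bang a ≡ a
      bang-t : ∀ {J} (a : Hom J C0) → t ∘ bang a ≡ 1C ∘ ! J
      bang-unique : ∀ {J} (a : Hom J C0) (h : Hom J C1) →
                    s ∘ h ≡ a → t ∘ h ≡ 1C ∘ ! J → h ≡ bang a

  _^_ : Obj → ℕ → Obj
  A ^ zero  = 𝟙
  A ^ suc n = A ⊗ (A ^ n)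

  pw : ∀ {A B} → Hom A B → (n : ℕ) → Hom (A ^ n) (B ^ n)
  pw f zero    = id
  pw f (suc n) = ⟨ f ∘ π₁ , pw f n ∘ π₂ ⟩

  private
    pw-π₁ : ∀ {A B J} (f : Hom A B) n (h : Hom J (A ^ suc n)) →
            π₁ ∘ (pw f (suc n) ∘ h) ≡ f ∘ (π₁ ∘ h)
    pw-π₁ f n h = trans (sym (assoc _ _ _))
                    (trans (cong (_∘ h) (β₁ _ _)) (assoc _ _ _))
    pw-π₂ : ∀ {A B J} (f : Hom A B) n (h : Hom J (A ^ suc n)) →
            π₂ ∘ (pw f (suc n) ∘ h) ≡ pw f n ∘ (π₂ ∘ h)
    pw-π₂ f n h = trans (sym (assoc _ _ _))
                    (trans (cong (_∘ h) (β₂ _ _)) (assoc _ _ _))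

  _^C_ : ICatData → ℕ → ICatData
  C ^C n = record
    { C0 = C0 ^ n ; C1 = C1 ^ n ; s = pw s n ; t = pw t n
    ; idm = pw idm n ; comp = compⁿ n }
    where
    open ICatData C
    compⁿ : ∀ n {J} (f g : Hom J (C1 ^ n)) → pw t n ∘ f ≡ pw s n ∘ g → Hom J (C1 ^ n)
    compⁿ zero {J} f g p = ! J
    compⁿ (suc n) f g p =
      ⟨ comp (π₁ ∘ f) (π₁ ∘ g)
          (trans (sym (pw-π₁ t n f)) (trans (cong (π₁ ∘_) p) (pw-π₁ s n g)))
      , compⁿ n (π₂ ∘ f) (π₂ ∘ g)
          (trans (sym (pw-π₂ t n f)) (trans (cong (π₂ ∘_) p) (pw-π₂ s n g))) ⟩

  _^F_ : ∀ {C D} → IFun C D → (n : ℕ) → IFun (C ^C n) (D ^C n)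
  F ^F n = record { F0 = pw (IFun.F0 F) n ; F1 = pw (IFun.F1 F) n }

  data Face : Set where
    ⊤f ⊥f : Face

  record RGData : Set (o ⊔ ℓ) where
    field
      X0 X1 : ICatData
      face  : Face → IFun X1 X0
      d     : IFun X0 X1

  record RGCat : Set (o ⊔ ℓ) where
    field
      dat : RGData
    open RGData dat public
    field
      X0-cat   : IsICat X0
      X1-cat   : IsICat X1
      face-fun : ∀ ⋆ → IsIFun (face ⋆)
      d-fun    : IsIFun d
      distinct : ¬ (face ⊤f ≈F face ⊥f)
      face∘d   : ∀ ⋆ → (face ⋆ ∘F d) ≈F idF

  _^RG_ : RGData → ℕ → RGData
  X ^RG n = record
    { X0 = X0 ^C n ; X1 = X1 ^C n
    ; face = λ ⋆ → face ⋆ ^F n ; d = d ^F n }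
    where open RGData X

  -- Reflexive graph natural transformations η : F → G, where
  -- F = (F₀ , F₁), G = (G₀ , G₁) are (pairs of) internal functors with
  -- degeneracy isomorphism components εF, εG.
  record RGNat (X Y : RGData)
               (F₀ G₀ : IFun (RGData.X0 X) (RGData.X0 Y))
               (F₁ G₁ : IFun (RGData.X1 X) (RGData.X1 Y))
               (εF εG : Hom (ICatData.C0 (RGData.X0 X)) (ICatData.C1 (RGData.X1 Y)))
               : Set (o ⊔ ℓ) where
    private
      module X = RGData X
      module Y = RGData Y
      module Y1 = ICatData Y.X1
    field
      η₀ : INat F₀ G₀
      η₁ : INat F₁ G₁
    open INat
    field
      face-pres : ∀ ⋆ → IFun.F1 (Y.face ⋆) ∘ α η₁ ≡ α η₀ ∘ IFun.F0 (X.face ⋆)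
      deg-pres  : ∀ (p : Y1.t ∘ εF ≡ Y1.s ∘ (α η₁ ∘ IFun.F0 X.d))
                    (q : Y1.t ∘ (IFun.F1 Y.d ∘ α η₀) ≡ Y1.s ∘ εG) →
                  Y1.comp εF (α η₁ ∘ IFun.F0 X.d) p
                    ≡ Y1.comp (IFun.F1 Y.d ∘ α η₀) εG q

  IsIsoI : (C : ICatData) {J : Obj} → Hom J (ICatData.C1 C) → Set ℓ
  IsIsoI C f =
    Σ[ g ∈ Hom _ C1 ]
      (s ∘ g ≡ t ∘ f) × (t ∘ g ≡ s ∘ f)
      × (∀ (p : t ∘ f ≡ s ∘ g) → comp f g p ≡ idm ∘ (s ∘ f))
      × (∀ (p : t ∘ g ≡ s ∘ f) → comp g f p ≡ idm ∘ (t ∘ f))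
    where open ICatData C

  IsGroupoid : ICatData → Set (o ⊔ ℓ)
  IsGroupoid C = ∀ {J} (f : Hom J (ICatData.C1 C)) → IsIsoI C f

  record RGCwI : Set (o ⊔ ℓ) where
    field
      𝒳 𝓜 : RGCat
    private
      module X = RGCat 𝒳
      module M = RGCat 𝓜
    field
      I₀ : IFun M.X0 X.X0
      I₁ : IFun M.X1 X.X1
      I₀-fun : IsIFun I₀
      I₁-fun : IsIFun I₁
      I-face : ∀ ⋆ → (X.face ⋆ ∘F I₁) ≈F (I₀ ∘F M.face ⋆)
      I-d    : (X.d ∘F I₀) ≈F (I₁ ∘F M.d)
      I₀-iso : Σ[ g ∈ Hom (ICatData.C0 X.X0) (ICatData.C0 M.X0) ]
                 (g ∘ IFun.F0 I₀ ≡ id) × (IFun.F0 I₀ ∘ g ≡ id)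
      I₁-iso : Σ[ g ∈ Hom (ICatData.C0 X.X1) (ICatData.C0 M.X1) ]
                 (g ∘ IFun.F0 I₁ ≡ id) × (IFun.F0 I₁ ∘ g ≡ id)
      I₀-mono : ∀ {J} (f g : Hom J (ICatData.C1 M.X0)) →
                IFun.F1 I₀ ∘ f ≡ IFun.F1 I₀ ∘ g → f ≡ g
      I₁-mono : ∀ {J} (f g : Hom J (ICatData.C1 M.X1)) →
                IFun.F1 I₁ ∘ f ≡ IFun.F1 I₁ ∘ g → f ≡ g
      M0-groupoid : IsGroupoid M.X0
      M1-groupoid : IsGroupoid M.X1

  -- The category  ℳⁿ → ℳ  (only its objects and hom-sets are needed).

  module _ (R : RGCwI) (n : ℕ) where
    private
      module R = RGCwI R
      module X = RGCat R.𝒳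
      module M = RGCat R.𝓜
      Mⁿ : RGData
      Mⁿ = M.dat ^RG n
      module Mⁿ = RGData Mⁿ

    record FunObj : Set (o ⊔ ℓ) where
      field
        F₀ : IFun Mⁿ.X0 M.X0
        F₁ : IFun Mⁿ.X1 M.X1
        F₀-fun : IsIFun F₀
        F₁-fun : IsIFun F₁
        face-pres : ∀ ⋆ → (M.face ⋆ ∘F F₁) ≈F (F₀ ∘F Mⁿ.face ⋆)
        ε : INatIso (M.d ∘F F₀) (F₁ ∘F Mⁿ.d)
        ε-face : ∀ ⋆ → IFun.F1 (M.face ⋆) ∘ INat.α (INatIso.to ε)
                       ≡ ICatData.idm M.X0 ∘ IFun.F0 F₀

      εI : Hom (ICatData.C0 Mⁿ.X0) (ICatData.C1 X.X1)
      εI = IFun.F1 R.I₁ ∘ INat.α (INatIso.to ε)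

    FunHom : FunObj → FunObj → Set (o ⊔ ℓ)
    FunHom F G = RGNat Mⁿ X.dat
                   (R.I₀ ∘F FunObj.F₀ F) (R.I₀ ∘F FunObj.F₀ G)
                   (R.I₁ ∘F FunObj.F₁ F) (R.I₁ ∘F FunObj.F₁ G)
                   (FunObj.εI F) (FunObj.εI G)

    _≈H_ : ∀ {F G} → FunHom F G → FunHom F G → Set ℓ
    η ≈H θ = (INat.α (RGNat.η₀ η) ≡ INat.α (RGNat.η₀ θ))
             × (INat.α (RGNat.η₁ η) ≡ INat.α (RGNat.η₁ θ))

    HasTerminalFun : Set (o ⊔ ℓ)
    HasTerminalFun =
      Σ[ T ∈ FunObj ] (∀ (F : FunObj) →
        Σ[ u ∈ FunHom F T ] (∀ (v : FunHom F T) → _≈H_ {F} {T} v u))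

  module _ (R : RGCwI) where
    private
      module R = RGCwI R
      module X = RGCat R.𝒳
      module X0 = ICatData X.X0
      module X1 = ICatData X.X1

    HasTerminals : Set (o ⊔ ℓ)
    HasTerminals = ITerminal X.X0 × ITerminal X.X1

    StableFace : HasTerminals → Set ℓ
    StableFace (T0 , T1) = ∀ ⋆ →
      (IFun.F0 (X.face ⋆) ∘ T1.1C ≡ T0.1C)
      × (T0.bang (IFun.F0 (X.face ⋆) ∘ T1.1C)
           ≡ X0.idm ∘ (IFun.F0 (X.face ⋆) ∘ T1.1C))
      where
      module T0 = ITerminal T0
      module T1 = ITerminal T1

    η¹ : (T : HasTerminals) → Hom 𝟙 X1.C1
    η¹ (T0 , T1) = ITerminal.bang T1 (IFun.F0 X.d ∘ ITerminal.1C T0)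

    StableDeg : HasTerminals → Set ℓ
    StableDeg T = IsIsoI X.X1 (η¹ T)
      × (Σ[ m ∈ Hom 𝟙 (ICatData.C1 (RGCat.X1 R.𝓜)) ] IFun.F1 R.I₁ ∘ m ≡ η¹ T)

module Submission where

-- The terminal object of ℳⁿ → ℳ is the constant reflexive graph functor
-- at the terminal objects.  Transport the terminals 1₀, 1₁ of 𝒳(0), 𝒳(1)
-- back along the object-isomorphisms ℐ(l)₀ to points c₀, c₁ of ℳ(0), ℳ(1),
-- and take T = (Δ c₀ , Δ c₁).  Stability under degeneracies provides a
-- morphism m of ℳ(1) with ℐ(1)₁ m = η¹ : d 1₀ → 1₁; it is invertible (ℳ is
-- a groupoid), so the constant transformation at m is the degeneracy
-- isomorphism ε_T.  Stability under face maps makes T face map-preserving.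
-- For any object F, the unique morphism F → T has components "the unique
-- arrow into the terminal object", ! (ℐ F(l)₀); face and degeneracy
-- preservation hold because both sides of each equation are arrows into a
-- terminal object.

open import Defs
open import Level using (_⊔_)
open import Data.Nat using (ℕ)
open import Data.Product using (_,_; proj₁; proj₂)
open import Relation.Binary.PropositionalEquality
  using (_≡_; refl; sym; trans; cong; subst; module ≡-Reasoning)
open import Axiom.UniquenessOfIdentityProofs.WithK using (uip)

module InternalFacts {o ℓ} (𝒞 : Category o ℓ) (P : FinProducts 𝒞) where
  open Category 𝒞
  open FinProducts P
  open Internal 𝒞 P
  open ≡-Reasoning

  point-unique : ∀ {J B} (k : Hom 𝟙 B) (u u' : Hom J 𝟙) → k ∘ u ≡ k ∘ u'
  point-unique k u u' = cong (k ∘_) (trans (!-unique u) (sym (!-unique u')))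

  point-∘ : ∀ {J K B} (k : Hom 𝟙 B) (u : Hom K 𝟙) (h : Hom J K) (u' : Hom J 𝟙) →
            (k ∘ u) ∘ h ≡ k ∘ u'
  point-∘ k u h u' = trans (assoc k u h) (point-unique k (u ∘ h) u')

  point-! : ∀ {B} (k : Hom 𝟙 B) → k ∘ ! 𝟙 ≡ k
  point-! k = trans (point-unique k (! 𝟙) id) (identityʳ k)

  reassoc : ∀ {A B C D} {f : Hom C D} {g : Hom B C} {h : Hom B D} →
            f ∘ g ≡ h → (x : Hom A B) → f ∘ (g ∘ x) ≡ h ∘ x
  reassoc e x = trans (sym (assoc _ _ _)) (cong (_∘ x) e)

  slide : ∀ {A B B' C D} {f : Hom C D} {g : Hom B C} {h : Hom B' D} {k : Hom B B'} →
          f ∘ g ≡ h ∘ k → (x : Hom A B) → f ∘ (g ∘ x) ≡ h ∘ (k ∘ x)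
  slide e x = trans (reassoc e x) (assoc _ _ _)

  retraction-injective : ∀ {A B J} {i : Hom A B} {r : Hom B A} → r ∘ i ≡ id →
                         (a b : Hom J A) → i ∘ a ≡ i ∘ b → a ≡ b
  retraction-injective {i = i} {r} ri a b e = begin
    a            ≡⟨ sym (identityˡ a) ⟩
    id ∘ a       ≡⟨ sym (reassoc ri a) ⟩
    r ∘ (i ∘ a)  ≡⟨ cong (r ∘_) e ⟩
    r ∘ (i ∘ b)  ≡⟨ reassoc ri b ⟩
    id ∘ b       ≡⟨ identityˡ b ⟩
    b            ∎

  section-cancel : ∀ {A B J} {i : Hom A B} {r : Hom B A} → i ∘ r ≡ id →
                   (x : Hom J B) → i ∘ (r ∘ x) ≡ x
  section-cancel ir x = trans (reassoc ir x) (identityˡ x)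

  comp-resp : (C : ICatData) {J : Obj} {f f' g g' : Hom J (ICatData.C1 C)}
              (p : ICatData.t C ∘ f ≡ ICatData.s C ∘ g)
              (p' : ICatData.t C ∘ f' ≡ ICatData.s C ∘ g') →
              f ≡ f' → g ≡ g' → ICatData.comp C f g p ≡ ICatData.comp C f' g' p'
  comp-resp C p p' refl refl = cong (ICatData.comp C _ _) (uip p p')

  comp-eval : (C : ICatData) {J : Obj} {f f' g g' r : Hom J (ICatData.C1 C)}
              (p : ICatData.t C ∘ f ≡ ICatData.s C ∘ g) → f ≡ f' → g ≡ g' →
              (∀ p' → ICatData.comp C f' g' p' ≡ r) → ICatData.comp C f g p ≡ r
  comp-eval C p refl refl k = k p

  module _ {C : ICatData} (C-cat : IsICat C) where
    open ICatData C
    open IsICat C-cat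

    idm-s∘ : ∀ {J} (x : Hom J C0) → s ∘ (idm ∘ x) ≡ x
    idm-s∘ x = trans (reassoc s-idm x) (identityˡ x)

    idm-t∘ : ∀ {J} (x : Hom J C0) → t ∘ (idm ∘ x) ≡ x
    idm-t∘ x = trans (reassoc t-idm x) (identityˡ x)

  module _ {C D : ICatData} {F : IFun C D} (F-fun : IsIFun F) where
    private
      module C = ICatData C
      module D = ICatData D
    open IFun F
    open IsIFun F-fun

    F-s∘ : ∀ {J} (f : Hom J C.C1) → D.s ∘ (F1 ∘ f) ≡ F0 ∘ (C.s ∘ f)
    F-s∘ = slide F-s

    F-t∘ : ∀ {J} (f : Hom J C.C1) → D.t ∘ (F1 ∘ f) ≡ F0 ∘ (C.t ∘ f)
    F-t∘ = slide F-t

    F-composable : ∀ {J} (f g : Hom J C.C1) → C.t ∘ f ≡ C.s ∘ g →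
                   D.t ∘ (F1 ∘ f) ≡ D.s ∘ (F1 ∘ g)
    F-composable f g p = trans (F-t∘ f) (trans (cong (F0 ∘_) p) (sym (F-s∘ g)))

  ∘F-fun : ∀ {B C D} {G : IFun C D} {F : IFun B C} → IsIFun G → IsIFun F → IsIFun (G ∘F F)
  ∘F-fun {B} {C} {D} {G} {F} G-fun F-fun = record
    { F-s = trans (F-s∘ G-fun F.F1) (trans (cong (G.F0 ∘_) (IsIFun.F-s F-fun)) (sym (assoc _ _ _)))
    ; F-t = trans (F-t∘ G-fun F.F1) (trans (cong (G.F0 ∘_) (IsIFun.F-t F-fun)) (sym (assoc _ _ _)))
    ; F-idm = trans (assoc _ _ _) (trans (cong (G.F1 ∘_) (IsIFun.F-idm F-fun))
                (slide (IsIFun.F-idm G-fun) F.F0))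
    ; F-comp = λ f g p q → begin
        (G.F1 ∘ F.F1) ∘ B.comp f g p
          ≡⟨ assoc _ _ _ ⟩
        G.F1 ∘ (F.F1 ∘ B.comp f g p)
          ≡⟨ cong (G.F1 ∘_) (IsIFun.F-comp F-fun f g p (qF f g p)) ⟩
        G.F1 ∘ C.comp (F.F1 ∘ f) (F.F1 ∘ g) (qF f g p)
          ≡⟨ IsIFun.F-comp G-fun _ _ _ (qG f g p) ⟩
        D.comp (G.F1 ∘ (F.F1 ∘ f)) (G.F1 ∘ (F.F1 ∘ g)) (qG f g p)
          ≡⟨ comp-resp D _ q (sym (assoc _ _ _)) (sym (assoc _ _ _)) ⟩
        D.comp ((G.F1 ∘ F.F1) ∘ f) ((G.F1 ∘ F.F1) ∘ g) q ∎
    }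
    where
    module B = ICatData B
    module C = ICatData C
    module D = ICatData D
    module F = IFun F
    module G = IFun G
    qF : ∀ {J} (f g : Hom J B.C1) → B.t ∘ f ≡ B.s ∘ g → C.t ∘ (F.F1 ∘ f) ≡ C.s ∘ (F.F1 ∘ g)
    qF = F-composable F-fun
    qG : ∀ {J} (f g : Hom J B.C1) → B.t ∘ f ≡ B.s ∘ g →
         D.t ∘ (G.F1 ∘ (F.F1 ∘ f)) ≡ D.s ∘ (G.F1 ∘ (F.F1 ∘ g))
    qG f g p = F-composable G-fun _ _ (qF f g p)

  Δ : (C : ICatData) {D : ICatData} → Hom 𝟙 (ICatData.C0 D) → IFun C D
  Δ C {D} x = record { F0 = x ∘ ! (ICatData.C0 C) ; F1 = ICatData.idm D ∘ (x ∘ ! (ICatData.C1 C)) }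

  record ConstAt {C D : ICatData} (F : IFun C D) (x : Hom 𝟙 (ICatData.C0 D)) : Set (o ⊔ ℓ) where
    constructor const-at
    field
      on-objects   : ∀ {J} (a : Hom J (ICatData.C0 C)) → IFun.F0 F ∘ a ≡ x ∘ ! J
      on-morphisms : ∀ {J} (f : Hom J (ICatData.C1 C)) →
                     IFun.F1 F ∘ f ≡ ICatData.idm D ∘ (x ∘ ! J)

    F0-const : IFun.F0 F ≡ x ∘ ! (ICatData.C0 C)
    F0-const = trans (sym (identityʳ _)) (on-objects id)

    F1-const : IFun.F1 F ≡ ICatData.idm D ∘ (x ∘ ! (ICatData.C1 C))
    F1-const = trans (sym (identityʳ _)) (on-morphisms id)

  open ConstAt

  Δ-const : ∀ C {D} (x : Hom 𝟙 (ICatData.C0 D)) → ConstAt (Δ C {D} x) x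
  Δ-const C {D} x = const-at (λ {J} a → point-∘ x _ a (! J))
    (λ f → trans (assoc _ _ _) (cong (ICatData.idm D ∘_) (point-∘ x _ f _)))

  const-pre : ∀ {B C D} {F : IFun C D} {x} (G : IFun B C) → ConstAt F x → ConstAt (F ∘F G) x
  const-pre G Fx = const-at (λ a → trans (assoc _ _ _) (on-objects Fx _))
                            (λ f → trans (assoc _ _ _) (on-morphisms Fx _))

  const-post : ∀ {C D E} {F : IFun C D} {H : IFun D E} {x} → IsIFun H → ConstAt F x →
               ConstAt (H ∘F F) (IFun.F0 H ∘ x)
  const-post {H = H} H-fun Fx = const-at
    (λ a → trans (assoc _ _ _) (trans (cong (IFun.F0 H ∘_) (on-objects Fx a)) (sym (assoc _ _ _))))
    (λ f → trans (assoc _ _ _) (trans (cong (IFun.F1 H ∘_) (on-morphisms Fx f))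
         (trans (slide (IsIFun.F-idm H-fun) _) (cong (_ ∘_) (sym (assoc _ _ _))))))

  const-≈F : ∀ {C D} {F G : IFun C D} {x} → ConstAt F x → ConstAt G x → F ≈F G
  const-≈F Fx Gx = trans (F0-const Fx) (sym (F0-const Gx)) , trans (F1-const Fx) (sym (F1-const Gx))

  const-fun : ∀ {C D} {F : IFun C D} {x} → IsICat D → ConstAt F x → IsIFun F
  const-fun {C} {D} {F} {x} D-cat Fx = record
    { F-s = trans (cong (D.s ∘_) (F1-const Fx)) (trans (idm-s∘ D-cat _) (sym (on-objects Fx C.s)))
    ; F-t = trans (cong (D.t ∘_) (F1-const Fx)) (trans (idm-t∘ D-cat _) (sym (on-objects Fx C.t)))
    ; F-idm = trans (on-morphisms Fx C.idm) (cong (D.idm ∘_) (sym (F0-const Fx)))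
    ; F-comp = λ {J} f g p q → trans (on-morphisms Fx _) (sym (comp-eval D q (on-morphisms Fx f)
        (trans (on-morphisms Fx g) (cong (D.idm ∘_) (sym (idm-t∘ D-cat (x ∘ ! J)))))
        (IsICat.unitˡ D-cat _)))
    }
    where
    module C = ICatData C
    module D = ICatData D

  const-nat : ∀ {C D} {F G : IFun C D} {x y} → IsICat D → ConstAt F x → ConstAt G y →
              (m : Hom 𝟙 (ICatData.C1 D)) → ICatData.s D ∘ m ≡ x → ICatData.t D ∘ m ≡ y →
              INat F G
  const-nat {C} {D} {F} {G} {x} {y} D-cat Fx Gy m m-s m-t = record
    { α = m ∘ ! C.C0
    ; α-s = trans (reassoc m-s _) (sym (F0-const Fx))
    ; α-t = trans (reassoc m-t _) (sym (F0-const Gy))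
    ; α-nat = λ {J} f p q → trans
        (comp-eval D p (point-∘ m _ _ (! J))
           (trans (on-morphisms Gy f) (cong (D.idm ∘_) (sym (reassoc m-t (! J)))))
           (IsICat.unitˡ D-cat (m ∘ ! J)))
        (sym (comp-eval D q (trans (on-morphisms Fx f) (cong (D.idm ∘_) (sym (reassoc m-s (! J)))))
           (point-∘ m _ _ (! J))
           (IsICat.unitʳ D-cat (m ∘ ! J))))
    }
    where
    module C = ICatData C
    module D = ICatData D

  const-iso : ∀ {C D} {F G : IFun C D} {x y} → IsICat D → ConstAt F x → ConstAt G y →
              (m : Hom 𝟙 (ICatData.C1 D)) → ICatData.s D ∘ m ≡ x → ICatData.t D ∘ m ≡ y →
              IsIsoI D m → INatIso F G
  const-iso {C} {D} {F} {G} D-cat Fx Gy m m-s m-t (m⁻¹ , m⁻¹-s , m⁻¹-t , m⁻¹∘m , m∘m⁻¹) = record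
    { to = const-nat D-cat Fx Gy m m-s m-t
    ; from = const-nat D-cat Gy Fx m⁻¹ (trans m⁻¹-s m-t) (trans m⁻¹-t m-s)
    ; from∘to = cancel m m⁻¹ (sym m⁻¹-s) m⁻¹∘m m-s Fx
    ; to∘from = cancel m⁻¹ m m⁻¹-t m∘m⁻¹ m-t Gy
    }
    where
    module C = ICatData C
    module D = ICatData D
    cancel : ∀ {H : IFun C D} {z w} (u v : Hom 𝟙 D.C1) (q : D.t ∘ u ≡ D.s ∘ v) →
             (∀ q → D.comp u v q ≡ D.idm ∘ w) → w ≡ z → ConstAt H z →
             ∀ p → D.comp (u ∘ ! C.C0) (v ∘ ! C.C0) p ≡ D.idm ∘ IFun.F0 H
    cancel {H} {z} {w} u v q uv w≡z Hz p = begin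
      D.comp (u ∘ ! C.C0) (v ∘ ! C.C0) p ≡⟨ IsICat.comp-nat D-cat u v q (! C.C0) p ⟩
      D.comp u v q ∘ ! C.C0              ≡⟨ cong (_∘ ! C.C0) (uv q) ⟩
      (D.idm ∘ w) ∘ ! C.C0               ≡⟨ assoc _ _ _ ⟩
      D.idm ∘ (w ∘ ! C.C0)               ≡⟨ cong (λ e → D.idm ∘ (e ∘ ! C.C0)) w≡z ⟩
      D.idm ∘ (z ∘ ! C.C0)               ≡⟨ cong (D.idm ∘_) (sym (F0-const Hz)) ⟩
      D.idm ∘ IFun.F0 H                  ∎

  module _ {C : ICatData} (C-cat : IsICat C) (T : ITerminal C) where
    open ICatData C
    open ITerminal T

    bang-∘ : ∀ {J K} (a : Hom K C0) (h : Hom J K) → bang a ∘ h ≡ bang (a ∘ h)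
    bang-∘ {J} {K} a h = bang-unique (a ∘ h) (bang a ∘ h) (reassoc (bang-s a) h)
      (trans (reassoc (bang-t a) h) (point-∘ 1C (! K) h (! J)))

    bang-1C : bang 1C ≡ idm ∘ 1C
    bang-1C = sym (bang-unique 1C (idm ∘ 1C) (idm-s∘ C-cat 1C)
      (trans (idm-t∘ C-cat 1C) (sym (point-! 1C))))

    comp-into-terminal : ∀ {J} (h k : Hom J C1) (p : t ∘ h ≡ s ∘ k) (x : Hom J C0) →
                         s ∘ h ≡ x → t ∘ k ≡ 1C ∘ ! J → comp h k p ≡ bang x
    comp-into-terminal h k p x h-s k-t = bang-unique x _
      (trans (IsICat.s-comp C-cat h k p) h-s) (trans (IsICat.t-comp C-cat h k p) k-t)

    module IntoTerminal {B : ICatData} {F G : IFun B C} (F-fun : IsIFun F) (G-fun : IsIFun G)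
             (G-terminal : IFun.F0 G ≡ 1C ∘ ! (ICatData.C0 B)) where
      private
        module B = ICatData B

      nat-into-terminal : INat F G
      nat-into-terminal = record
        { α = bang (IFun.F0 F)
        ; α-s = bang-s _
        ; α-t = trans (bang-t _) (sym G-terminal)
        ; α-nat = λ {J} f p q → trans
            (comp-into-terminal _ _ p _ (reassoc (bang-s _) (B.s ∘ f))
               (trans (F-t∘ G-fun f) (trans (cong (_∘ (B.t ∘ f)) G-terminal)
                 (point-∘ 1C _ _ (! J)))))
            (sym (comp-into-terminal _ _ q _ (F-s∘ F-fun f)
               (trans (cong (t ∘_) (bang-∘ _ (B.t ∘ f))) (bang-t _))))
        }

      nat-into-terminal-unique : (η : INat F G) → INat.α η ≡ bang (IFun.F0 F)
      nat-into-terminal-unique η = bang-unique _ _ (INat.α-s η)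
        (trans (INat.α-t η) G-terminal)

  bang-preserved : ∀ {C D} {H : IFun C D} → IsIFun H → (TC : ITerminal C) (TD : ITerminal D) →
                   IFun.F0 H ∘ ITerminal.1C TC ≡ ITerminal.1C TD →
                   ∀ {J} (x : Hom J (ICatData.C0 C)) →
                   IFun.F1 H ∘ ITerminal.bang TC x ≡ ITerminal.bang TD (IFun.F0 H ∘ x)
  bang-preserved {H = H} H-fun TC TD H1 {J} x = ITerminal.bang-unique TD _ _
    (trans (F-s∘ H-fun _) (cong (IFun.F0 H ∘_) (ITerminal.bang-s TC x)))
    (trans (F-t∘ H-fun _) (trans (cong (IFun.F0 H ∘_) (ITerminal.bang-t TC x)) (reassoc H1 (! J))))

module TerminalFunctor {o ℓ} (𝒞 : Category o ℓ) (P : FinProducts 𝒞) where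
  open Category 𝒞
  open FinProducts P
  open Internal 𝒞 P
  open InternalFacts 𝒞 P
  open ≡-Reasoning

  module _ (R : RGCwI)
           (T0 : ITerminal (RGCat.X0 (RGCwI.𝒳 R))) (T1 : ITerminal (RGCat.X1 (RGCwI.𝒳 R)))
           (face-stable : StableFace R (T0 , T1))
           (m : Hom 𝟙 (ICatData.C1 (RGCat.X1 (RGCwI.𝓜 R))))
           (m-lifts-η¹ : IFun.F1 (RGCwI.I₁ R) ∘ m ≡ η¹ R (T0 , T1)) where
    private
      module R = RGCwI R
      module X = RGCat R.𝒳
      module M = RGCat R.𝓜
      module X0 = ICatData X.X0
      module X1 = ICatData X.X1
      module M0 = ICatData M.X0
      module M1 = ICatData M.X1
      module T0 = ITerminal T0
      module T1 = ITerminal T1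
      module I0 = IFun R.I₀
      module I1 = IFun R.I₁
      module Xd = IFun X.d
      module Md = IFun M.d
      module Xf (⋆ : Face) = IFun (X.face ⋆)
      module Mf (⋆ : Face) = IFun (M.face ⋆)

    c0 : Hom 𝟙 M0.C0
    c0 = proj₁ R.I₀-iso ∘ T0.1C

    c1 : Hom 𝟙 M1.C0
    c1 = proj₁ R.I₁-iso ∘ T1.1C

    I-c0 : I0.F0 ∘ c0 ≡ T0.1C
    I-c0 = section-cancel (proj₂ (proj₂ R.I₀-iso)) T0.1C

    I-c1 : I1.F0 ∘ c1 ≡ T1.1C
    I-c1 = section-cancel (proj₂ (proj₂ R.I₁-iso)) T1.1C

    -- the faces of c₁ are c₀, since ℐ(0)₀ is injective
    face-c1 : ∀ ⋆ → Mf.F0 ⋆ ∘ c1 ≡ c0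
    face-c1 ⋆ = retraction-injective (proj₁ (proj₂ R.I₀-iso)) _ _ (begin
      I0.F0 ∘ (Mf.F0 ⋆ ∘ c1)  ≡⟨ sym (slide (proj₁ (R.I-face ⋆)) c1) ⟩
      Xf.F0 ⋆ ∘ (I1.F0 ∘ c1)  ≡⟨ cong (Xf.F0 ⋆ ∘_) I-c1 ⟩
      Xf.F0 ⋆ ∘ T1.1C         ≡⟨ proj₁ (face-stable ⋆) ⟩
      T0.1C                   ≡⟨ sym I-c0 ⟩
      I0.F0 ∘ c0              ∎)

    m-s : M1.s ∘ m ≡ Md.F0 ∘ c0
    m-s = retraction-injective (proj₁ (proj₂ R.I₁-iso)) _ _ (begin
      I1.F0 ∘ (M1.s ∘ m)      ≡⟨ sym (F-s∘ R.I₁-fun m) ⟩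
      X1.s ∘ (I1.F1 ∘ m)      ≡⟨ cong (X1.s ∘_) m-lifts-η¹ ⟩
      X1.s ∘ η¹ R (T0 , T1)   ≡⟨ T1.bang-s _ ⟩
      Xd.F0 ∘ T0.1C           ≡⟨ cong (Xd.F0 ∘_) (sym I-c0) ⟩
      Xd.F0 ∘ (I0.F0 ∘ c0)    ≡⟨ slide (proj₁ R.I-d) c0 ⟩
      I1.F0 ∘ (Md.F0 ∘ c0)    ∎)

    m-t : M1.t ∘ m ≡ c1
    m-t = retraction-injective (proj₁ (proj₂ R.I₁-iso)) _ _ (begin
      I1.F0 ∘ (M1.t ∘ m)      ≡⟨ sym (F-t∘ R.I₁-fun m) ⟩
      X1.t ∘ (I1.F1 ∘ m)      ≡⟨ cong (X1.t ∘_) m-lifts-η¹ ⟩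
      X1.t ∘ η¹ R (T0 , T1)   ≡⟨ T1.bang-t _ ⟩
      T1.1C ∘ ! 𝟙             ≡⟨ point-! T1.1C ⟩
      T1.1C                   ≡⟨ sym I-c1 ⟩
      I1.F0 ∘ c1              ∎)

    -- ... whose faces are identities: the faces of η¹ are arrows 1₀ → 1₀
    face-m : ∀ ⋆ → Mf.F1 ⋆ ∘ m ≡ M0.idm ∘ c0
    face-m ⋆ = R.I₀-mono _ _ (begin
      I0.F1 ∘ (Mf.F1 ⋆ ∘ m)                  ≡⟨ sym (slide (proj₂ (R.I-face ⋆)) m) ⟩
      Xf.F1 ⋆ ∘ (I1.F1 ∘ m)                  ≡⟨ cong (Xf.F1 ⋆ ∘_) m-lifts-η¹ ⟩
      Xf.F1 ⋆ ∘ T1.bang (Xd.F0 ∘ T0.1C)      ≡⟨ bang-preserved (X.face-fun ⋆) T1 T0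
                                                   (proj₁ (face-stable ⋆)) _ ⟩
      T0.bang (Xf.F0 ⋆ ∘ (Xd.F0 ∘ T0.1C))    ≡⟨ cong T0.bang (section-cancel
                                                   (proj₁ (X.face∘d ⋆)) T0.1C) ⟩
      T0.bang T0.1C                          ≡⟨ bang-1C X.X0-cat T0 ⟩
      X0.idm ∘ T0.1C                         ≡⟨ cong (X0.idm ∘_) (sym I-c0) ⟩
      X0.idm ∘ (I0.F0 ∘ c0)                  ≡⟨ sym (slide (IsIFun.F-idm R.I₀-fun) c0) ⟩
      I0.F1 ∘ (M0.idm ∘ c0)                  ∎)

    module _ (n : ℕ) where
      private
        Mⁿ0 Mⁿ1 : ICatData
        Mⁿ0 = M.X0 ^C n
        Mⁿ1 = M.X1 ^C n
        module Mⁿ0 = ICatData Mⁿ0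
        module Mⁿ1 = ICatData Mⁿ1

        Δc0 : ConstAt (Δ Mⁿ0 {M.X0} c0) c0
        Δc0 = Δ-const Mⁿ0 c0

        Δc1 : ConstAt (Δ Mⁿ1 {M.X1} c1) c1
        Δc1 = Δ-const Mⁿ1 c1

      terminal : FunObj R n
      terminal = record
        { F₀ = Δ Mⁿ0 c0
        ; F₁ = Δ Mⁿ1 c1
        ; F₀-fun = const-fun M.X0-cat Δc0
        ; F₁-fun = const-fun M.X1-cat Δc1
        ; face-pres = λ ⋆ → const-≈F
            (subst (ConstAt (M.face ⋆ ∘F Δ Mⁿ1 c1)) (face-c1 ⋆)
               (const-post (M.face-fun ⋆) Δc1))
            (const-pre (M.face ⋆ ^F n) Δc0)
        ; ε = const-iso M.X1-cat (const-post M.d-fun Δc0)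
                (const-pre (M.d ^F n) Δc1) m m-s m-t (R.M1-groupoid m)
        ; ε-face = λ ⋆ → slide (face-m ⋆) (! Mⁿ0.C0)
        }

      module _ (F : FunObj R n) where
        private
          module F = FunObj F
          module F₀ = IFun F.F₀
          module F₁ = IFun F.F₁
          a : Hom Mⁿ0.C0 X0.C0
          a = I0.F0 ∘ F₀.F0
          b : Hom Mⁿ1.C0 X1.C0
          b = I1.F0 ∘ F₁.F0

          -- at each level, ℐ ∘ terminal is constant at the terminal object of 𝒳
          module Into₀ = IntoTerminal X.X0-cat T0 (∘F-fun R.I₀-fun F.F₀-fun)
                           (∘F-fun R.I₀-fun (FunObj.F₀-fun terminal)) (reassoc I-c0 (! Mⁿ0.C0))
          module Into₁ = IntoTerminal X.X1-cat T1 (∘F-fun R.I₁-fun F.F₁-fun)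
                           (∘F-fun R.I₁-fun (FunObj.F₁-fun terminal)) (reassoc I-c1 (! Mⁿ1.C0))

        IF-face : ∀ ⋆ → Xf.F0 ⋆ ∘ b ≡ a ∘ IFun.F0 (M.face ⋆ ^F n)
        IF-face ⋆ = begin
          Xf.F0 ⋆ ∘ (I1.F0 ∘ F₁.F0)          ≡⟨ slide (proj₁ (R.I-face ⋆)) F₁.F0 ⟩
          I0.F0 ∘ (Mf.F0 ⋆ ∘ F₁.F0)          ≡⟨ cong (I0.F0 ∘_) (proj₁ (F.face-pres ⋆)) ⟩
          I0.F0 ∘ (F₀.F0 ∘ IFun.F0 (M.face ⋆ ^F n)) ≡⟨ sym (assoc _ _ _) ⟩
          a ∘ IFun.F0 (M.face ⋆ ^F n)        ∎

        εI-s : X1.s ∘ FunObj.εI F ≡ Xd.F0 ∘ a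
        εI-s = begin
          X1.s ∘ (I1.F1 ∘ INat.α (INatIso.to F.ε))   ≡⟨ F-s∘ R.I₁-fun _ ⟩
          I1.F0 ∘ (M1.s ∘ INat.α (INatIso.to F.ε))   ≡⟨ cong (I1.F0 ∘_) (INat.α-s (INatIso.to F.ε)) ⟩
          I1.F0 ∘ (Md.F0 ∘ F₀.F0)                    ≡⟨ sym (slide (proj₁ R.I-d) F₀.F0) ⟩
          Xd.F0 ∘ a                                  ∎

        to-terminal : FunHom R n F terminal
        to-terminal = record
          { η₀ = Into₀.nat-into-terminal
          ; η₁ = Into₁.nat-into-terminal
          ; face-pres = λ ⋆ → begin
              Xf.F1 ⋆ ∘ T1.bang b                 ≡⟨ bang-preserved (X.face-fun ⋆) T1 T0
                                                       (proj₁ (face-stable ⋆)) b ⟩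
              T0.bang (Xf.F0 ⋆ ∘ b)               ≡⟨ cong T0.bang (IF-face ⋆) ⟩
              T0.bang (a ∘ IFun.F0 (M.face ⋆ ^F n)) ≡⟨ sym (bang-∘ X.X0-cat T0 a _) ⟩
              T0.bang a ∘ IFun.F0 (M.face ⋆ ^F n) ∎
          ; deg-pres = λ p q → trans
              (comp-into-terminal X.X1-cat T1 _ _ p (Xd.F0 ∘ a) εI-s
                 (trans (cong (X1.t ∘_) (bang-∘ X.X1-cat T1 b _)) (T1.bang-t _)))
              (sym (comp-into-terminal X.X1-cat T1 _ _ q (Xd.F0 ∘ a)
                 (trans (F-s∘ X.d-fun _) (cong (Xd.F0 ∘_) (T0.bang-s a)))
                 (trans (F-t∘ R.I₁-fun _) (trans (cong (I1.F0 ∘_) (reassoc m-t _))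
                   (trans (reassoc I-c1 _) (point-unique T1.1C _ _))))))
          }

        to-terminal-unique : ∀ (v : FunHom R n F terminal) → _≈H_ R n {F} {terminal} v to-terminal
        to-terminal-unique v = Into₀.nat-into-terminal-unique (RGNat.η₀ v)
                             , Into₁.nat-into-terminal-unique (RGNat.η₁ v)

      has-terminal : HasTerminalFun R n
      has-terminal = terminal , λ F → to-terminal F , to-terminal-unique F

lemma41 : ∀ {o ℓ} (𝒞 : Category o ℓ) (P : FinProducts 𝒞) (R : Internal.RGCwI 𝒞 P)
          (T : Internal.HasTerminals 𝒞 P R) →
          Internal.StableFace 𝒞 P R T → Internal.StableDeg 𝒞 P R T →
          (n : ℕ) → Internal.HasTerminalFun 𝒞 P R n
lemma41 𝒞 P R (T0 , T1) face-stable (_ , m , m-lifts-η¹) =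
  TerminalFunctor.has-terminal 𝒞 P R T0 T1 face-stable m m-lifts-η¹
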